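{- Let $T$ be an $r\times 2$ standard Young tableau, let $(a,b)$ be a northwest corner of $\mathrm{path}(T)$, and let $(x_1,y_1)$ and $(x_2,y_2)$ be two distinct markers of $\pi(T)$ both lying southeast of $(a,b)$ (i.e., $x_i>a$ and $y_i<b$). Then one of these two markers lies southeast of the other, i.e., $x_1<x_2$ if and only if $y_1>y_2$.
   Context: An $r\times 2$ standard Young tableau is a filling of the rectangle with $r$ rows and $2$ columns by $1,\dots,2r$, increasing along rows and down columns. $\mathrm{path}(T)$ is the lattice path from $(1,0)$ to $(r+1,r)$ whose $i$-th unit step is north if $i$ is in the first column of $T$ and east otherwise. A northwest corner of the path is the endpoint of a north step that is followed by an east step. The markers of $\pi(T)$ are constructed as follows: place a marker at each northwest corner of the path and draw rays east and south from each; then repeatedly place a marker at a northwest-most point of $\{1,\dots,r\}^2$ lying on or below the path that is not yet marked or covered by a ray, drawing rays east and south from it; this stops after $r$ markers. The permutation $\pi(T)\in S_r$ is defined by $\pi(T)(r+1-y)=x$ for each marker $(x,y)$; it avoids the pattern $132$. -}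

module Defs where

open import Data.Nat using (ℕ; zero; suc; _+_; _*_; _∸_; _≤_; _<_; _≡ᵇ_)
open import Data.Bool using (Bool; true; false; if_then_else_)
open import Data.Fin as Fin using (Fin)
open import Data.List using (List; _∷_; allFin)
open import Data.Bool.ListAction using (any)
open import Data.List.Membership.Propositional using (_∈_)
open import Data.Product using (_×_; _,_; ∃; Σ; proj₁; proj₂)
open import Data.Sum using (_⊎_)
open import Relation.Binary.PropositionalEquality using (_≡_)
open import Relation.Nullary using (¬_)
open import Function.Bundles using (_⇔_)

-- An r × 2 standard Young tableau: entry i j is the entry in row i (row 0 on top)
-- and column j (column 0 = first column).
record SYT (r : ℕ) : Set where
  field
    entry     : Fin r → Fin 2 → ℕ
    inRange   : ∀ i j → 1 ≤ entry i j × entry i j ≤ 2 * r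
    injective : ∀ i j i′ j′ → entry i j ≡ entry i′ j′ → (i ≡ i′ × j ≡ j′)
    surjective : ∀ n → 1 ≤ n → n ≤ 2 * r → ∃ λ i → ∃ λ j → entry i j ≡ n
    rowInc    : ∀ i → entry i Fin.zero < entry i (Fin.suc Fin.zero)
    colInc    : ∀ (i i′ : Fin r) j → i Fin.< i′ → entry i j < entry i′ j
open SYT public

-- Is n in the first column of T?  (Then the n-th step of path(T) is north.)
inFirstCol : ∀ {r} → SYT r → ℕ → Bool
inFirstCol {r} T n = any (λ i → entry T i Fin.zero ≡ᵇ n) (allFin r)

nCount : ∀ {r} → SYT r → ℕ → ℕ
nCount T zero = zero
nCount T (suc k) = (if inFirstCol T (suc k) then 1 else 0) + nCount T k

eCount : ∀ {r} → SYT r → ℕ → ℕ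
eCount T k = k ∸ nCount T k

Point : Set
Point = ℕ × ℕ

-- the lattice point of path(T) reached after k steps, starting at (1,0)
pathPt : ∀ {r} → SYT r → ℕ → Point
pathPt T k = (1 + eCount T k , nCount T k)

-- (a,b) is a northwest corner: endpoint of a north step i followed by an east step i+1
NWCorner : ∀ {r} → SYT r → Point → Set
NWCorner {r} T p = ∃ λ i → 1 ≤ i × i < 2 * r
  × inFirstCol T i ≡ true × inFirstCol T (suc i) ≡ false × pathPt T i ≡ p

OnOrBelow : ∀ {r} → SYT r → Point → Set
OnOrBelow {r} T (x , y) = ∃ λ k → k ≤ 2 * r × proj₁ (pathPt T k) ≡ x × y ≤ proj₂ (pathPt T k)

InGrid : ℕ → Point → Set
InGrid r (x , y) = (1 ≤ x × x ≤ r) × (1 ≤ y × y ≤ r)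

-- p is marked or covered by the rays east and south drawn from marker m
Covers : Point → Point → Set
Covers (mx , my) (px , py) = (py ≡ my × mx ≤ px) ⊎ (px ≡ mx × py ≤ my)

Available : ∀ {r} → SYT r → List Point → Point → Set
Available {r} T M p = InGrid r p × OnOrBelow T p × (∀ m → m ∈ M → ¬ Covers m p)

NWMost : ∀ {r} → SYT r → List Point → Point → Set
NWMost T M (x , y) = Available T M (x , y)
  × (∀ x′ y′ → Available T M (x′ , y′) → x′ ≤ x → y ≤ y′ → (x′ , y′) ≡ (x , y))

-- Partial runs of the marker construction of π(T): start from the set of northwest
-- corners, then repeatedly add a northwest-most available point.
data Run {r} (T : SYT r) : List Point → Set where
  start : (M : List Point) → (∀ p → p ∈ M ⇔ NWCorner T p) → Run T M
  step  : ∀ {M} p → Run T M → NWMost T M p → Run T (p ∷ M)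

-- A completed run: no available point remains; M is then the set of markers of π(T).
Markers : ∀ {r} → SYT r → List Point → Set
Markers T M = Run T M × (∀ p → ¬ Available T M p)

{-# OPTIONS --safe #-}
module Submission where

-- The markers form a rook placement: the corners do because the path is a staircase
-- (of two distinct corners one is strictly northeast of the other), and each later
-- marker is available, hence shares no row or column with an earlier one.  Now let
-- A and B be markers southeast of a corner (a , b) with B strictly northeast of A.
-- East of the corner the path stays at height ≥ b > y_B, so the point in A's column
-- and B's row lies below the path; its column is covered only by A and its row only
-- by B, in both cases from the wrong side.  So it is still available, contradicting
-- that the construction has stopped.

open import Defs
open import Data.Nat
  using (ℕ; zero; suc; _≤_; _<_; _≤′_; ≤′-refl; ≤′-step; s≤s; _≤?_)
open import Data.Nat.Properties
open import Data.Bool using (true; false)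
open import Data.Product using (_×_; _,_; proj₁; proj₂)
open import Data.Sum using (_⊎_; inj₁; inj₂)
open import Data.List using (List; _∷_)
open import Data.List.Relation.Unary.Any using (here; there)
open import Data.List.Membership.Propositional using (_∈_)
open import Relation.Binary using (tri<; tri≈; tri>)
open import Relation.Binary.PropositionalEquality using (_≡_; _≢_; refl; sym; cong; ≢-sym)
open import Relation.Nullary using (¬_; yes; no; contradiction)
open import Function.Bundles using (_⇔_; mk⇔; Equivalence)

_⇘_ : Point → Point → Set
(a , b) ⇘ (x , y) = a < x × y < b

_⇗_ : Point → Point → Set
(a , b) ⇗ (x , y) = a < x × b < y

Apart : Point → Point → Set
Apart (px , py) (qx , qy) = px ≢ qx × py ≢ qy

Apart-sym : ∀ {p q} → Apart p q → Apart q p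
Apart-sym (x≢ , y≢) = ≢-sym x≢ , ≢-sym y≢

⇗⇒Apart : ∀ {p q} → p ⇗ q → Apart p q
⇗⇒Apart (x< , y<) = <⇒≢ x< , <⇒≢ y<

mono-by-step : (f : ℕ → ℕ) → (∀ k → f k ≤ f (suc k)) → ∀ {k l} → k ≤ l → f k ≤ f l
mono-by-step f grows k≤l = go (≤⇒≤′ k≤l)
  where
  go : ∀ {k l} → k ≤′ l → f k ≤ f l
  go ≤′-refl = ≤-refl
  go (≤′-step k≤′l) = ≤-trans (go k≤′l) (grows _)

module _ {r : ℕ} (T : SYT r) where

  nCount-north : ∀ {k} → inFirstCol T (suc k) ≡ true → nCount T (suc k) ≡ suc (nCount T k)
  nCount-north north rewrite north = refl

  nCount≤ : ∀ k → nCount T k ≤ k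
  nCount≤ zero = ≤-refl
  nCount≤ (suc k) with inFirstCol T (suc k)
  ... | true = s≤s (nCount≤ k)
  ... | false = m≤n⇒m≤1+n (nCount≤ k)

  nCount-mono : ∀ {k l} → k ≤ l → nCount T k ≤ nCount T l
  nCount-mono = mono-by-step (nCount T) one-step
    where
    one-step : ∀ k → nCount T k ≤ nCount T (suc k)
    one-step k with inFirstCol T (suc k)
    ... | true = n≤1+n _
    ... | false = ≤-refl

  eCount-east : ∀ {k} → inFirstCol T (suc k) ≡ false → eCount T (suc k) ≡ suc (eCount T k)
  eCount-east {k} east rewrite east = +-∸-assoc 1 (nCount≤ k)

  eCount-mono : ∀ {k l} → k ≤ l → eCount T k ≤ eCount T l
  eCount-mono = mono-by-step (eCount T) one-step
    where
    one-step : ∀ k → eCount T k ≤ eCount T (suc k)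
    one-step k with inFirstCol T (suc k)
    ... | true = ≤-refl
    ... | false = ∸-monoˡ-≤ (nCount T k) (n≤1+n k)

  -- eCount T k unfolds to k ∸ nCount T k, from which k cannot be inferred; hence the
  -- explicit indices at the uses of the lemmas below.
  eCount<⇒< : ∀ {k l} → eCount T k < eCount T l → k < l
  eCount<⇒< lt = ≰⇒> (λ l≤k → <⇒≱ lt (eCount-mono l≤k))

  eCount<⇒nCount≤ : ∀ {k l} → eCount T k < eCount T l → nCount T k ≤ nCount T l
  eCount<⇒nCount≤ {k} {l} lt = nCount-mono (<⇒≤ (eCount<⇒< {k} {l} lt))

  nCount<-west-of-north-step : ∀ {i k} → inFirstCol T (suc i) ≡ true →
    eCount T k < eCount T (suc i) → nCount T k < nCount T (suc i)
  nCount<-west-of-north-step {i} {k} north lt =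
    ≤-trans (s≤s (nCount-mono (≤-pred (eCount<⇒< {k} {suc i} lt))))
            (≤-reflexive (sym (nCount-north north)))

  nCount≤-in-column-of-east-step : ∀ {i k} → inFirstCol T (suc i) ≡ false →
    eCount T k ≡ eCount T i → nCount T k ≤ nCount T i
  nCount≤-in-column-of-east-step {i} {k} east eq = nCount-mono (≮⇒≥ i<k⇒⊥)
    where
    i<k⇒⊥ : ¬ i < k
    i<k⇒⊥ i<k = <-irrefl (sym eq)
      (≤-trans (≤-reflexive (sym (eCount-east {i} east))) (eCount-mono i<k))

  later-corner-northeast : ∀ {i j} → i < j → inFirstCol T (suc i) ≡ false →
    1 ≤ j → inFirstCol T j ≡ true → pathPt T i ⇗ pathPt T j
  later-corner-northeast {i} {suc j} i<j east _ north =
    s≤s e< , nCount<-west-of-north-step {j} {i} north e<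
    where
    e< : eCount T i < eCount T (suc j)
    e< = ≤-trans (≤-reflexive (sym (eCount-east {i} east))) (eCount-mono i<j)

  corners-comparable : ∀ {p q} → NWCorner T p → NWCorner T q → p ≢ q →
    p ⇗ q ⊎ q ⇗ p
  corners-comparable (i , 1≤i , _ , north-i , east-i , refl)
                     (j , 1≤j , _ , north-j , east-j , refl) p≢q with <-cmp i j
  ... | tri< i<j _ _ = inj₁ (later-corner-northeast i<j east-i 1≤j north-j)
  ... | tri≈ _ refl _ = contradiction refl p≢q
  ... | tri> _ _ j<i = inj₂ (later-corner-northeast j<i east-j 1≤i north-i)

  corner-not-southeast-of-corner : ∀ {a b x y} → NWCorner T (a , b) → NWCorner T (x , y) →
    ¬ (a , b) ⇘ (x , y)
  corner-not-southeast-of-corner cp cq (a<x , y<b)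
    with corners-comparable cp cq (λ { refl → <-irrefl refl a<x })
  ... | inj₁ (_ , b<y) = <-asym b<y y<b
  ... | inj₂ (x<a , _) = <-asym a<x x<a

  onOrBelow-east-of-path : ∀ {i a b x y y′} → pathPt T i ≡ (a , b) →
    OnOrBelow T (x , y) → a < x → y′ ≤ b → OnOrBelow T (x , y′)
  onOrBelow-east-of-path {i} refl (k , k≤ , refl , _) a<x y′≤b =
    k , k≤ , refl , ≤-trans y′≤b (eCount<⇒nCount≤ {i} {k} (≤-pred a<x))

  corner-uncovered⇒Apart : ∀ {m p} → NWCorner T m → OnOrBelow T p → ¬ Covers m p →
    Apart p m
  corner-uncovered⇒Apart {p = _ , py} (suc i , _ , _ , north , east , refl)
                         (k , _ , refl , py≤) uncovered = column , row
    where
    row : py ≢ nCount T (suc i)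
    row eq with suc (eCount T (suc i)) ≤? suc (eCount T k)
    ... | yes le = uncovered (inj₁ (eq , le))
    ... | no nle = <⇒≱ (nCount<-west-of-north-step {i} {k} north (≤-pred (≰⇒> nle)))
                       (≤-trans (≤-reflexive (sym eq)) py≤)
    column : suc (eCount T k) ≢ suc (eCount T (suc i))
    column eq with py ≤? nCount T (suc i)
    ... | yes le = uncovered (inj₂ (eq , le))
    ... | no nle = <⇒≱ (≰⇒> nle)
        (≤-trans py≤ (nCount≤-in-column-of-east-step {suc i} {k} east (suc-injective eq)))

  nwMost-uncovered⇒Apart : ∀ {M p q} → NWMost T M q → Available T M p → ¬ Covers q p →
    Apart p q
  nwMost-uncovered⇒Apart {p = px , py} {q = qx , qy} (_ , minimal) avp uncovered =
    column , row
    where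
    row : py ≢ qy
    row eq with qx ≤? px
    ... | yes le = uncovered (inj₁ (eq , le))
    ... | no nle = nle (≤-reflexive (sym (cong proj₁
            (minimal px py avp (<⇒≤ (≰⇒> nle)) (≤-reflexive (sym eq))))))
    column : px ≢ qx
    column eq with py ≤? qy
    ... | yes le = uncovered (inj₂ (eq , le))
    ... | no nle = nle (≤-reflexive (cong proj₂
            (minimal px py avp (≤-reflexive eq) (<⇒≤ (≰⇒> nle)))))

  available-∷⁻ : ∀ {q M p} → Available T (q ∷ M) p → Available T M p × ¬ Covers q p
  available-∷⁻ (grid , below , uncovered) =
    (grid , below , λ m m∈ → uncovered m (there m∈)) , uncovered _ (here refl)

  available-Apart : ∀ {M p m} → Run T M → Available T M p → m ∈ M → Apart p m
  available-Apart (start _ corners) (_ , below , uncovered) m∈ =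
    corner-uncovered⇒Apart (Equivalence.to (corners _) m∈) below (uncovered _ m∈)
  available-Apart (step _ _ nwMost) av (here refl) =
    let (avM , uncovered) = available-∷⁻ av in nwMost-uncovered⇒Apart nwMost avM uncovered
  available-Apart (step _ R _) av (there m∈) =
    available-Apart R (proj₁ (available-∷⁻ av)) m∈

  markers-Apart : ∀ {M p q} → Run T M → p ∈ M → q ∈ M → p ≢ q → Apart p q
  markers-Apart (start _ corners) p∈ q∈ p≢q
    with corners-comparable (Equivalence.to (corners _) p∈)
                            (Equivalence.to (corners _) q∈) p≢q
  ... | inj₁ p⇗q = ⇗⇒Apart p⇗q
  ... | inj₂ q⇗p = Apart-sym (⇗⇒Apart q⇗p)
  markers-Apart (step _ _ _) (here refl) (here refl) p≢q = contradiction refl p≢q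
  markers-Apart (step _ R (avp , _)) (here refl) (there q∈) _ = available-Apart R avp q∈
  markers-Apart (step _ R (avq , _)) (there p∈) (here refl) _ =
    Apart-sym (available-Apart R avq p∈)
  markers-Apart (step _ R _) (there p∈) (there q∈) p≢q = markers-Apart R p∈ q∈ p≢q

  marker-corner-or-placed : ∀ {M m} → Run T M → m ∈ M →
    NWCorner T m ⊎ (InGrid r m × OnOrBelow T m)
  marker-corner-or-placed (start _ corners) m∈ = inj₁ (Equivalence.to (corners _) m∈)
  marker-corner-or-placed (step _ _ ((grid , below , _) , _)) (here refl) =
    inj₂ (grid , below)
  marker-corner-or-placed (step _ R _) (there m∈) = marker-corner-or-placed R m∈

  no-marker-northeast-of-marker-southeast-of-corner : ∀ {M c A B} → Markers T M →
    NWCorner T c → A ∈ M → B ∈ M → c ⇘ A → c ⇘ B → ¬ A ⇗ B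
  no-marker-northeast-of-marker-southeast-of-corner {M} {A = xA , yA} {B = xB , yB}
    (R , complete) corner@(i , _ , _ , _ , _ , atCorner) A∈ B∈ c⇘A c⇘B (xA<xB , yA<yB)
    with marker-corner-or-placed R A∈ | marker-corner-or-placed R B∈
  ... | inj₁ cornerA | _ = corner-not-southeast-of-corner corner cornerA c⇘A
  ... | inj₂ _ | inj₁ cornerB = corner-not-southeast-of-corner corner cornerB c⇘B
  ... | inj₂ (gridA , belowA) | inj₂ (gridB , _) =
    complete (xA , yB) ((proj₁ gridA , proj₂ gridB) , below , uncovered)
    where
    below : OnOrBelow T (xA , yB)
    below = onOrBelow-east-of-path {i} atCorner belowA (proj₁ c⇘A) (<⇒≤ (proj₂ c⇘B))
    uncovered : ∀ m → m ∈ M → ¬ Covers m (xA , yB)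
    uncovered (mx , my) m∈ (inj₁ (yB≡my , mx≤xA)) =
      proj₂ (markers-Apart R B∈ m∈ λ { refl → <⇒≱ xA<xB mx≤xA }) yB≡my
    uncovered (mx , my) m∈ (inj₂ (xA≡mx , yB≤my)) =
      proj₁ (markers-Apart R A∈ m∈ λ { refl → <⇒≱ yA<yB yB≤my }) xA≡mx

lemma4p3 : ∀ (r : ℕ) (T : SYT r) (M : List Point) → Markers T M →
    ∀ a b → NWCorner T (a , b) →
    ∀ x₁ y₁ x₂ y₂ → (x₁ , y₁) ∈ M → (x₂ , y₂) ∈ M → (x₁ , y₁) ≢ (x₂ , y₂) →
    a < x₁ → y₁ < b → a < x₂ → y₂ < b →
    (x₁ < x₂ ⇔ y₂ < y₁)
lemma4p3 r T M markers a b corner x₁ y₁ x₂ y₂ m₁ m₂ m₁≢m₂ a<x₁ y₁<b a<x₂ y₂<b =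
  mk⇔ (λ x₁<x₂ → ≤∧≢⇒< (≮⇒≥ λ y₁<y₂ →
         not-northeast m₁ m₂ (a<x₁ , y₁<b) (a<x₂ , y₂<b) (x₁<x₂ , y₁<y₂)) (≢-sym y₁≢y₂))
      (λ y₂<y₁ → ≤∧≢⇒< (≮⇒≥ λ x₂<x₁ →
         not-northeast m₂ m₁ (a<x₂ , y₂<b) (a<x₁ , y₁<b) (x₂<x₁ , y₂<y₁)) x₁≢x₂)
  where
  not-northeast : ∀ {A B} → A ∈ M → B ∈ M → (a , b) ⇘ A → (a , b) ⇘ B → ¬ A ⇗ B
  not-northeast = no-marker-northeast-of-marker-southeast-of-corner T markers corner

  x₁≢x₂ : x₁ ≢ x₂
  x₁≢x₂ = proj₁ (markers-Apart T (proj₁ markers) m₁ m₂ m₁≢m₂)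

  y₁≢y₂ : y₁ ≢ y₂
  y₁≢y₂ = proj₂ (markers-Apart T (proj₁ markers) m₁ m₂ m₁≢m₂)
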